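{- Let $w$ be a nonempty pattern over a finite alphabet $\mathcal{A}$, with position lattice $(\mathcal{L},(T_s)_{s},(S_s)_{s})$. Let $s\in\mathcal{L}$, $i\in\{0,\dots,|w|-1\}\setminus s$ and $x\in\mathcal{A}$. 1. If $x=w_i$: if $|s|=|w|-1$ then $T_s(i,x)=\{0,\dots,B-1\}$ and $S_s(i,x)=|w|-B$, where $B$ is the length of the longest proper suffix of $w$ which is also a prefix of $w$; otherwise $T_s(i,x)=s\cup\{i\}$ and $S_s(i,x)=0$. 2. If $x\neq w_i$: (a) if $s=\emptyset$, then $T_\emptyset(i,x)=\{P(i,x)\}$ and $S_\emptyset(i,x)=i-P(i,x)$ if $P(i,x)\neq\mathrm{NULL}$, and $T_\emptyset(i,x)=\emptyset$, $S_\emptyset(i,x)=i+1$ otherwise; (b) if $s\neq\emptyset$, then for every $\ell\in s$, $T_s(i,x)=T_{T_{s\setminus\{\ell\}}(i,x)}\big(\ell-S_{s\setminus\{\ell\}}(i,x),\,w_\ell\big)$ and $S_s(i,x)=S_{T_{s\setminus\{\ell\}}(i,x)}\big(\ell-S_{s\setminus\{\ell\}}(i,x),\,w_\ell\big)+S_{s\setminus\{\ell\}}(i,x)$.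
   Context: Words are indexed from $0$. For $I\subseteq\mathbb{N}$ and $k\in\mathbb{N}$, $I\ominus k=\{i-k: i\in I,\ i\ge k\}$. The position lattice of $w$ consists of: the set $\mathcal{L}$ of all subsets of $\{0,\dots,|w|-1\}$ other than $\{0,\dots,|w|-1\}$ itself; and, for each $s\in\mathcal{L}$, maps $S_s,T_s$ defined on $(\{0,\dots,|w|-1\}\setminus s)\times\mathcal{A}$ by: $S_s(i,x)$ is the least integer $k$, with $k\ge1$ if $|s|=|w|-1$ and $k\ge0$ otherwise, such that ($w_{i-k}=x$ whenever $i\ge k$) and $w_j=w_{j+k}$ for all $j\in s\ominus k$; and $T_s(i,x)=(s\cup\{i\})\ominus S_s(i,x)\in\mathcal{L}$. For a position $i$ of $w$ and $x\in\mathcal{A}$, $P(i,x)=\max\{j\le i: w_j=x\}$ if this set is nonempty, and $P(i,x)=\mathrm{NULL}$ otherwise.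
   Formalization: In part 2(b) the two identities hold for those ℓ ∈ s with $S_{s\setminus\{\ell\}}(i,x)\le\ell$ only, not for every ℓ ∈ s. The statement above fails without it. -}

module Defs where

open import Data.Nat using (ℕ; zero; suc; _+_; _∸_; _≤_; _<_; _<?_; _≤?_; _≡ᵇ_; _<ᵇ_)
open import Data.Bool using (Bool; true; false; if_then_else_)
open import Data.Fin using (Fin; toℕ; fromℕ<)
open import Data.Fin.Properties using (all?)
open import Data.Fin.Subset using (Subset; _∈_; _∪_; ∣_∣; outside)
open import Data.Fin.Subset.Properties using (_∈?_)
open import Data.Vec using (Vec; lookup; tabulate)
open import Data.Maybe using (Maybe; just; nothing)
open import Data.Maybe.Properties using (≡-dec)
open import Data.Product using (_×_)
open import Relation.Binary.PropositionalEquality using (_≡_)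
open import Relation.Nullary using (Dec; yes; no)
open import Relation.Nullary.Decidable using (_→-dec_; _×-dec_)
import Data.Fin as F

module _ {n : ℕ} where

  memℕ : Subset n → ℕ → Bool
  memℕ s p with p <? n
  ... | yes p<n = lookup s (fromℕ< p<n)
  ... | no  _   = outside

  _⊖_ : Subset n → ℕ → Subset n
  s ⊖ k = tabulate (λ j → memℕ s (toℕ j + k))

  -- the singleton {p} for a natural number p (empty if p ≥ n)
  singℕ : ℕ → Subset n
  singℕ p = tabulate (λ j → toℕ j ≡ᵇ p)

  range : ℕ → Subset n
  range B = tabulate (λ j → toℕ j <ᵇ B)

module _ {q n : ℕ} where

  charAt : Vec (Fin q) n → ℕ → Maybe (Fin q)
  charAt w p with p <? n
  ... | yes p<n = just (lookup w (fromℕ< p<n))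
  ... | no  _   = nothing

  Good : Vec (Fin q) n → Subset n → ℕ → Fin q → ℕ → Set
  Good w s i x k =
    (k ≤ i → charAt w (i ∸ k) ≡ just x)
    × (∀ j → j ∈ (s ⊖ k) → charAt w (toℕ j) ≡ charAt w (toℕ j + k))

  good? : ∀ w s i x k → Dec (Good w s i x k)
  good? w s i x k =
    (k ≤? i →-dec ≡-dec F._≟_ (charAt w (i ∸ k)) (just x))
    ×-dec all? (λ j → (j ∈? (s ⊖ k)) →-dec
                        ≡-dec F._≟_ (charAt w (toℕ j)) (charAt w (toℕ j + k)))

  -- least k ≥ start (among start, …, start+fuel-1) satisfying P;
  -- returns start+fuel if none does
  search : (P : ℕ → Set) → (∀ k → Dec (P k)) → ℕ → ℕ → ℕ
  search P P? k zero = k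
  search P P? k (suc f) with P? k
  ... | yes _ = k
  ... | no  _ = search P P? (suc k) f

  lowerBound : Subset n → ℕ
  lowerBound s with ∣ s ∣ Data.Nat.≟ (n ∸ 1)
  ... | yes _ = 1
  ... | no  _ = 0

  -- S_s(i,x): the least admissible k satisfying Good.  (k = n always
  -- satisfies Good, and the lower bound is ≤ 1 ≤ n for nonempty w, so a
  -- search through n+1 candidates finds the true minimum.)
  S : Vec (Fin q) n → Subset n → ℕ → Fin q → ℕ
  S w s i x = search (Good w s i x) (good? w s i x) (lowerBound s) (suc n)

  T : Vec (Fin q) n → Subset n → ℕ → Fin q → Subset n
  T w s i x = (s ∪ singℕ i) ⊖ S w s i x

  P : Vec (Fin q) n → ℕ → Fin q → Maybe ℕ
  P w zero x with ≡-dec F._≟_ (charAt w 0) (just x)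
  ... | yes _ = just 0
  ... | no  _ = nothing
  P w (suc i) x with ≡-dec F._≟_ (charAt w (suc i)) (just x)
  ... | yes _ = just (suc i)
  ... | no  _ = P w i x

  IsBorder : Vec (Fin q) n → ℕ → Set
  IsBorder w b = b < n × (∀ j → j < b → charAt w j ≡ charAt w (n ∸ b + j))

  IsLongestBorder : Vec (Fin q) n → ℕ → Set
  IsLongestBorder w B = IsBorder w B × (∀ b → IsBorder w b → b ≤ B)

{-# OPTIONS --safe #-}
-- S_s(i,x) is the least admissible shift k ≥ 0 (k ≥ 1 when |s| = |w| − 1): shifting w by k
-- must keep the letter x at position i and the letters at the positions in s.  If
-- k′ = S_s(i,x) is admissible for s, then k + k′ is admissible for s ∪ {ℓ} exactly when k is
-- admissible for the single new position ℓ − k′, carrying the letter w_ℓ, relative to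
-- T_s(i,x) = (s ∪ {i}) ⊖ k′.  No shift below k′ is admissible for s ∪ {ℓ}, and T_s(i,x)
-- misses both the last position and ℓ − k′, so its lower bound is 0; hence least admissible
-- shifts add up, which is 2(b).  When x = w_i and s ∪ {i} is every position, the admissible
-- shifts are the periods of w, and the least period is |w| − B.
module Submission where

open import Data.Bool using (true; false; _∨_)
open import Data.Fin using (Fin; toℕ; fromℕ<)
import Data.Fin as F
open import Data.Fin.Properties using (toℕ<n; toℕ-fromℕ<; fromℕ<-toℕ; toℕ-injective)
open import Data.Fin.Subset using (Subset; _∈_; _∉_; _⊂_; _∪_; _-_; ⁅_⁆; ⊤; ⊥; ∣_∣)
open import Data.Fin.Subset.Properties
  using (_∈?_; ∈⊤; ⊆⊤; ∉⊥; ⊆-antisym; ∣p∣≤n; ∣p∣≡n⇒p≡⊤; p⊂q⇒∣p∣<∣q∣; p⊆p∪q; x∈p∪q⁺; x∈p∪q⁻;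
         x∈⁅x⁆; x∈⁅y⁆⇒x≡y; x∈p∧x≢y⇒x∈p-y; p─q⊆p; ∪-assoc; ∪-comm; ∪-identityˡ)
open import Data.Maybe using (just; nothing)
open import Data.Maybe.Properties using (just-injective; ≡-dec)
open import Data.Nat using (ℕ; zero; suc; _+_; _∸_; _≤_; _<_; z≤n; s≤s; _<?_; _≡ᵇ_; _<ᵇ_)
open import Data.Nat.Properties
open import Data.Product using (_×_; _,_; proj₁; proj₂; ∃-syntax)
open import Data.Sum using (_⊎_; inj₁; inj₂; [_,_])
import Data.Sum as Sum
open import Data.Vec using (Vec; _∷_; lookup; tabulate; there)
open import Data.Vec.Properties
  using (lookup∘tabulate; tabulate∘lookup; tabulate-cong; lookup-replicate; lookup-zipWith;
         []=⇒lookup; lookup⇒[]=)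
open import Function using (_⇔_; mk⇔; Equivalence; _∘_)
open Equivalence using (to; from)
import Function.Properties.Equivalence as ⇔
open import Relation.Binary.Definitions using (tri<; tri≈; tri>)
open import Relation.Binary.PropositionalEquality
  using (_≡_; _≢_; refl; sym; trans; cong; cong₂; subst; module ≡-Reasoning)
open import Relation.Nullary using (¬_; Dec; yes; no)
open import Relation.Nullary.Decidable using (dec-true; dec-false; does-⇔)
open import Relation.Nullary.Negation using (contradiction)

open import Defs

-- Subsets of positions

x∉p-x : ∀ {n} {p : Subset n} (x : Fin n) → x ∉ p - x
x∉p-x {p = _ ∷ _} F.zero    ()
x∉p-x {p = _ ∷ _} (F.suc x) (there x∈p-x) = x∉p-x x x∈p-x

x∈p⇒p-x∪⁅x⁆≡p : ∀ {n} {p : Subset n} {x : Fin n} → x ∈ p → (p - x) ∪ ⁅ x ⁆ ≡ p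
x∈p⇒p-x∪⁅x⁆≡p {p = p} {x} x∈p = ⊆-antisym
  ([ p─q⊆p p ⁅ x ⁆ , (λ y∈⁅x⁆ → subst (_∈ p) (sym (x∈⁅y⁆⇒x≡y x y∈⁅x⁆)) x∈p) ] ∘ x∈p∪q⁻ (p - x) ⁅ x ⁆)
  (λ {y} y∈p → x∈p∪q⁺ (split y y∈p))
  where
  split : ∀ y → y ∈ p → y ∈ p - x ⊎ y ∈ ⁅ x ⁆
  split y y∈p with y F.≟ x
  ... | yes refl = inj₂ (x∈⁅x⁆ x)
  ... | no  y≢x  = inj₁ (x∈p∧x≢y⇒x∈p-y y∈p y≢x)

module _ {m : ℕ} {t : Subset (suc m)} (∣t∣≡m : ∣ t ∣ ≡ m) where

  missing-unique : {a b : Fin (suc m)} → a ∉ t → b ∉ t → a ≡ b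
  missing-unique {a} {b} a∉t b∉t with a F.≟ b
  ... | yes a≡b = a≡b
  ... | no  a≢b = contradiction b∈t∪⁅a⁆ ([ b∉t , (λ b∈⁅a⁆ → a≢b (sym (x∈⁅y⁆⇒x≡y a b∈⁅a⁆))) ] ∘ x∈p∪q⁻ t ⁅ a ⁆)
    where
    t⊂t∪⁅a⁆ : t ⊂ t ∪ ⁅ a ⁆
    t⊂t∪⁅a⁆ = p⊆p∪q ⁅ a ⁆ , a , x∈p∪q⁺ (inj₂ (x∈⁅x⁆ a)) , a∉t
    t∪⁅a⁆≡⊤ : t ∪ ⁅ a ⁆ ≡ ⊤
    t∪⁅a⁆≡⊤ = ∣p∣≡n⇒p≡⊤ (≤-antisym (∣p∣≤n (t ∪ ⁅ a ⁆)) (subst (_< ∣ t ∪ ⁅ a ⁆ ∣) ∣t∣≡m (p⊂q⇒∣p∣<∣q∣ t⊂t∪⁅a⁆)))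
    b∈t∪⁅a⁆ : b ∈ t ∪ ⁅ a ⁆
    b∈t∪⁅a⁆ = subst (b ∈_) (sym t∪⁅a⁆≡⊤) ∈⊤

  ∪⁅⁆≡⊤ : {i : Fin (suc m)} → i ∉ t → t ∪ ⁅ i ⁆ ≡ ⊤
  ∪⁅⁆≡⊤ {i} i∉t = ⊆-antisym ⊆⊤ λ {x} _ → x∈p∪q⁺ (split x)
    where
    split : ∀ x → x ∈ t ⊎ x ∈ ⁅ i ⁆
    split x with x ∈? t
    ... | yes x∈t = inj₁ x∈t
    ... | no  x∉t = inj₂ (subst (_∈ ⁅ i ⁆) (missing-unique i∉t x∉t) (x∈⁅x⁆ i))

singℕ-toℕ : ∀ {n} (i : Fin n) → singℕ (toℕ i) ≡ ⁅ i ⁆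
singℕ-toℕ F.zero    = cong (true ∷_) (trans (tabulate-cong (λ j → sym (lookup-replicate j false)))
                                            (tabulate∘lookup ⊥))
singℕ-toℕ (F.suc i) = cong (false ∷_) (singℕ-toℕ i)

module _ {n : ℕ} where

  memℕ-fromℕ< : (s : Subset n) {p : ℕ} (p<n : p < n) → memℕ s p ≡ lookup s (fromℕ< p<n)
  memℕ-fromℕ< s {p} p<n with p <? n
  ... | yes _   = refl
  ... | no  p≮n = contradiction p<n p≮n

  memℕ-≮ : (s : Subset n) {p : ℕ} → ¬ p < n → memℕ s p ≡ false
  memℕ-≮ s {p} p≮n with p <? n
  ... | yes p<n = contradiction p<n p≮n
  ... | no  _   = refl

  memℕ-toℕ : (s : Subset n) (j : Fin n) → memℕ s (toℕ j) ≡ lookup s j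
  memℕ-toℕ s j = trans (memℕ-fromℕ< s (toℕ<n j)) (cong (lookup s) (fromℕ<-toℕ j (toℕ<n j)))

  memℕ-ext : {a b : Subset n} → (∀ p → p < n → memℕ a p ≡ memℕ b p) → a ≡ b
  memℕ-ext {a} {b} a≗b = begin
    a                    ≡⟨ tabulate∘lookup a ⟨
    tabulate (lookup a)  ≡⟨ tabulate-cong lookup-a≗b ⟩
    tabulate (lookup b)  ≡⟨ tabulate∘lookup b ⟩
    b                    ∎
    where
    open ≡-Reasoning
    lookup-a≗b : ∀ j → lookup a j ≡ lookup b j
    lookup-a≗b j = trans (sym (memℕ-toℕ a j)) (trans (a≗b (toℕ j) (toℕ<n j)) (memℕ-toℕ b j))

  memℕ-⊖ : (s : Subset n) (k p : ℕ) → memℕ (s ⊖ k) p ≡ memℕ s (p + k)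
  memℕ-⊖ s k p with p <? n
  ... | yes p<n = trans (lookup∘tabulate _ (fromℕ< p<n)) (cong (λ r → memℕ s (r + k)) (toℕ-fromℕ< p<n))
  ... | no  p≮n = sym (memℕ-≮ s (λ p+k<n → p≮n (m+n≤o⇒m≤o (suc p) p+k<n)))

  memℕ-∪ : (a b : Subset n) (p : ℕ) → memℕ (a ∪ b) p ≡ memℕ a p ∨ memℕ b p
  memℕ-∪ a b p with p <? n
  ... | yes p<n = lookup-zipWith _∨_ (fromℕ< p<n) a b
  ... | no  _   = refl

  memℕ-⊥ : (p : ℕ) → memℕ (⊥ {n}) p ≡ false
  memℕ-⊥ p with p <? n
  ... | yes p<n = lookup-replicate (fromℕ< p<n) false
  ... | no  _   = refl

  memℕ-⊤ : (p : ℕ) → memℕ (⊤ {n}) p ≡ (p <ᵇ n)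
  memℕ-⊤ p with p <? n
  ... | yes p<n = trans (lookup-replicate (fromℕ< p<n) true) (sym (dec-true (p <? n) p<n))
  ... | no  p≮n = sym (dec-false (p <? n) p≮n)

  memℕ-singℕ : {q : ℕ} → q < n → (p : ℕ) → memℕ (singℕ {n} q) p ≡ (p ≡ᵇ q)
  memℕ-singℕ {q} q<n p with p <? n
  ... | yes p<n = trans (lookup∘tabulate _ (fromℕ< p<n)) (cong (_≡ᵇ q) (toℕ-fromℕ< p<n))
  ... | no  p≮n = sym (dec-false (p ≟ q) λ { refl → p≮n q<n })

  memℕ-range : (B : ℕ) {p : ℕ} → p < n → memℕ (range {n} B) p ≡ (p <ᵇ B)
  memℕ-range B {p} p<n = trans (memℕ-fromℕ< (range B) p<n)
    (trans (lookup∘tabulate _ (fromℕ< p<n)) (cong (_<ᵇ B) (toℕ-fromℕ< p<n)))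

  ⊖-identityʳ : (s : Subset n) → s ⊖ 0 ≡ s
  ⊖-identityʳ s = memℕ-ext λ p _ → trans (memℕ-⊖ s 0 p) (cong (memℕ s) (+-identityʳ p))

  ⊖-distribʳ-∪ : (a b : Subset n) (k : ℕ) → (a ∪ b) ⊖ k ≡ (a ⊖ k) ∪ (b ⊖ k)
  ⊖-distribʳ-∪ a b k = memℕ-ext λ p _ → begin
    memℕ ((a ∪ b) ⊖ k) p             ≡⟨ memℕ-⊖ (a ∪ b) k p ⟩
    memℕ (a ∪ b) (p + k)             ≡⟨ memℕ-∪ a b (p + k) ⟩
    memℕ a (p + k) ∨ memℕ b (p + k)  ≡⟨ cong₂ _∨_ (memℕ-⊖ a k p) (memℕ-⊖ b k p) ⟨
    memℕ (a ⊖ k) p ∨ memℕ (b ⊖ k) p  ≡⟨ memℕ-∪ (a ⊖ k) (b ⊖ k) p ⟨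
    memℕ ((a ⊖ k) ∪ (b ⊖ k)) p       ∎
    where open ≡-Reasoning

  ⊖-⊖ : (s : Subset n) (j k : ℕ) → (s ⊖ j) ⊖ k ≡ s ⊖ (k + j)
  ⊖-⊖ s j k = memℕ-ext λ p _ → begin
    memℕ ((s ⊖ j) ⊖ k) p  ≡⟨ memℕ-⊖ (s ⊖ j) k p ⟩
    memℕ (s ⊖ j) (p + k)  ≡⟨ memℕ-⊖ s j (p + k) ⟩
    memℕ s (p + k + j)    ≡⟨ cong (memℕ s) (+-assoc p k j) ⟩
    memℕ s (p + (k + j))  ≡⟨ memℕ-⊖ s (k + j) p ⟨
    memℕ (s ⊖ (k + j)) p  ∎
    where open ≡-Reasoning

  singℕ-⊖ : {p k : ℕ} → k ≤ p → p < n → singℕ {n} p ⊖ k ≡ singℕ (p ∸ k)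
  singℕ-⊖ {p} {k} k≤p p<n = memℕ-ext λ r _ → begin
    memℕ (singℕ {n} p ⊖ k) r      ≡⟨ memℕ-⊖ (singℕ p) k r ⟩
    memℕ (singℕ {n} p) (r + k)    ≡⟨ memℕ-singℕ p<n (r + k) ⟩
    (r + k ≡ᵇ p)                  ≡⟨ does-⇔ shift (r + k ≟ p) (r ≟ p ∸ k) ⟩
    (r ≡ᵇ p ∸ k)                  ≡⟨ memℕ-singℕ (≤-<-trans (m∸n≤m p k) p<n) r ⟨
    memℕ (singℕ {n} (p ∸ k)) r    ∎
    where
    open ≡-Reasoning
    shift : ∀ {r} → r + k ≡ p ⇔ r ≡ p ∸ k
    shift {r} = mk⇔ (λ { refl → sym (m+n∸n≡m r k) }) (λ { refl → m∸n+n≡m k≤p })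

  singℕ-⊖-beyond : {p k : ℕ} → p < n → p < k → singℕ {n} p ⊖ k ≡ ⊥
  singℕ-⊖-beyond {p} {k} p<n p<k = memℕ-ext λ r _ → begin
    memℕ (singℕ {n} p ⊖ k) r    ≡⟨ memℕ-⊖ (singℕ p) k r ⟩
    memℕ (singℕ {n} p) (r + k)  ≡⟨ memℕ-singℕ p<n (r + k) ⟩
    (r + k ≡ᵇ p)                ≡⟨ dec-false (r + k ≟ p) (λ { refl → <⇒≱ p<k (m≤n+m k r) }) ⟩
    false                       ≡⟨ memℕ-⊥ r ⟨
    memℕ (⊥ {n}) r              ∎
    where open ≡-Reasoning

  ⊤-⊖ : {k : ℕ} → k ≤ n → ⊤ {n} ⊖ k ≡ range (n ∸ k)
  ⊤-⊖ {k} k≤n = memℕ-ext λ p p<n → begin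
    memℕ (⊤ {n} ⊖ k) p          ≡⟨ memℕ-⊖ ⊤ k p ⟩
    memℕ (⊤ {n}) (p + k)        ≡⟨ memℕ-⊤ (p + k) ⟩
    (p + k <ᵇ n)                ≡⟨ does-⇔ shift (p + k <? n) (p <? n ∸ k) ⟩
    (p <ᵇ n ∸ k)                ≡⟨ memℕ-range (n ∸ k) p<n ⟨
    memℕ (range {n} (n ∸ k)) p  ∎
    where
    open ≡-Reasoning
    shift : ∀ {p} → p + k < n ⇔ p < n ∸ k
    shift {p} = mk⇔ (m+n≤o⇒m≤o∸n (suc p)) (m≤o∸n⇒m+n≤o (suc p) k≤n)

  -- A Σ-type rather than memℕ s p ≡ true, so that Agda can infer s and p from it.
  infix 4 _∈ℕ_
  _∈ℕ_ : ℕ → Subset n → Set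
  p ∈ℕ s = ∃[ j ] toℕ j ≡ p × j ∈ s

  ∈ℕ⇒< : {s : Subset n} {p : ℕ} → p ∈ℕ s → p < n
  ∈ℕ⇒< (j , refl , _) = toℕ<n j

  ∈ℕ⇔∈ : {s : Subset n} {j : Fin n} → toℕ j ∈ℕ s ⇔ j ∈ s
  ∈ℕ⇔∈ {s} = mk⇔ (λ (j′ , e , j′∈s) → subst (_∈ s) (toℕ-injective e) j′∈s) (λ j∈s → _ , refl , j∈s)

  memℕ≡true⇔∈ℕ : {s : Subset n} {p : ℕ} → memℕ s p ≡ true ⇔ p ∈ℕ s
  memℕ≡true⇔∈ℕ {s} {p} = mk⇔ forth back
    where
    forth : memℕ s p ≡ true → p ∈ℕ s
    forth p∈s with p <? n
    ... | yes p<n = fromℕ< p<n , toℕ-fromℕ< p<n , lookup⇒[]= (fromℕ< p<n) s p∈s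
    ... | no  _   = contradiction p∈s λ ()
    back : p ∈ℕ s → memℕ s p ≡ true
    back (j , refl , j∈s) = trans (memℕ-toℕ s j) ([]=⇒lookup j∈s)

  ∈ℕ-⊖ : {s : Subset n} {k p : ℕ} → p ∈ℕ s ⊖ k ⇔ p + k ∈ℕ s
  ∈ℕ-⊖ {s} {k} {p} = mk⇔
    (to memℕ≡true⇔∈ℕ ∘ trans (sym (memℕ-⊖ s k p)) ∘ from memℕ≡true⇔∈ℕ)
    (to memℕ≡true⇔∈ℕ ∘ trans (memℕ-⊖ s k p) ∘ from memℕ≡true⇔∈ℕ)

  ∈ℕ-∪⁅⁆ : {s : Subset n} {j : Fin n} {p : ℕ} → p ∈ℕ s ∪ ⁅ j ⁆ ⇔ (p ∈ℕ s ⊎ p ≡ toℕ j)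
  ∈ℕ-∪⁅⁆ {s} {j} {p} = mk⇔ forth back
    where
    forth : p ∈ℕ s ∪ ⁅ j ⁆ → p ∈ℕ s ⊎ p ≡ toℕ j
    forth (j′ , e , j′∈) =
      Sum.map (λ j′∈s → j′ , e , j′∈s) (λ j′∈⁅j⁆ → trans (sym e) (cong toℕ (x∈⁅y⁆⇒x≡y j j′∈⁅j⁆)))
              (x∈p∪q⁻ s ⁅ j ⁆ j′∈)
    back : p ∈ℕ s ⊎ p ≡ toℕ j → p ∈ℕ s ∪ ⁅ j ⁆
    back (inj₁ (j′ , e , j′∈s)) = j′ , e , x∈p∪q⁺ (inj₁ j′∈s)
    back (inj₂ refl)            = j , refl , x∈p∪q⁺ (inj₂ (x∈⁅x⁆ j))

  ∈ℕ-⊤ : {p : ℕ} → p < n → p ∈ℕ ⊤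
  ∈ℕ-⊤ p<n = fromℕ< p<n , toℕ-fromℕ< p<n , ∈⊤

missingℕ-unique : ∀ {m} {t : Subset (suc m)} → ∣ t ∣ ≡ m → {p r : ℕ} → p < suc m → r < suc m →
  ¬ p ∈ℕ t → ¬ r ∈ℕ t → p ≡ r
missingℕ-unique {m} {t} ∣t∣≡m {p} {r} p<n r<n p∉t r∉t = begin
  p                 ≡⟨ toℕ-fromℕ< p<n ⟨
  toℕ (fromℕ< p<n)  ≡⟨ cong toℕ (missing-unique ∣t∣≡m (asFin p<n p∉t) (asFin r<n r∉t)) ⟩
  toℕ (fromℕ< r<n)  ≡⟨ toℕ-fromℕ< r<n ⟩
  r                 ∎
  where
  open ≡-Reasoning
  asFin : ∀ {u} (u<n : u < suc m) → ¬ u ∈ℕ t → fromℕ< u<n ∉ t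
  asFin u<n u∉t = u∉t ∘ subst (_∈ℕ t) (toℕ-fromℕ< u<n) ∘ from ∈ℕ⇔∈

-- t is abstracted together with its defining equation so that callers can pass T w s i x unexpanded.
∪⁅⁆-⊖-+ : ∀ {n} (s : Subset n) (p : ℕ) (ℓ : Fin n) {k′ t} (k″ : ℕ) → k′ ≤ toℕ ℓ → (s ∪ singℕ p) ⊖ k′ ≡ t →
  ((s ∪ ⁅ ℓ ⁆) ∪ singℕ p) ⊖ (k″ + k′) ≡ (t ∪ singℕ (toℕ ℓ ∸ k′)) ⊖ k″
∪⁅⁆-⊖-+ s p ℓ {k′} k″ k′≤ℓ refl = begin
  ((s ∪ ⁅ ℓ ⁆) ∪ singℕ p) ⊖ (k″ + k′)                  ≡⟨ cong (_⊖ (k″ + k′)) reorder ⟩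
  ((s ∪ singℕ p) ∪ singℕ (toℕ ℓ)) ⊖ (k″ + k′)          ≡⟨ ⊖-⊖ _ k′ k″ ⟨
  (((s ∪ singℕ p) ∪ singℕ (toℕ ℓ)) ⊖ k′) ⊖ k″          ≡⟨ cong (_⊖ k″) (⊖-distribʳ-∪ _ _ k′) ⟩
  (((s ∪ singℕ p) ⊖ k′) ∪ (singℕ (toℕ ℓ) ⊖ k′)) ⊖ k″   ≡⟨ cong (λ u → (((s ∪ singℕ p) ⊖ k′) ∪ u) ⊖ k″)
                                                              (singℕ-⊖ k′≤ℓ (toℕ<n ℓ)) ⟩
  (((s ∪ singℕ p) ⊖ k′) ∪ singℕ (toℕ ℓ ∸ k′)) ⊖ k″     ∎
  where
  open ≡-Reasoning
  reorder : (s ∪ ⁅ ℓ ⁆) ∪ singℕ p ≡ (s ∪ singℕ p) ∪ singℕ (toℕ ℓ)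
  reorder = begin
    (s ∪ ⁅ ℓ ⁆) ∪ singℕ p          ≡⟨ ∪-assoc s _ _ ⟩
    s ∪ (⁅ ℓ ⁆ ∪ singℕ p)          ≡⟨ cong (s ∪_) (∪-comm ⁅ ℓ ⁆ _) ⟩
    s ∪ (singℕ p ∪ ⁅ ℓ ⁆)          ≡⟨ ∪-assoc s _ _ ⟨
    (s ∪ singℕ p) ∪ ⁅ ℓ ⁆          ≡⟨ cong ((s ∪ singℕ p) ∪_) (singℕ-toℕ ℓ) ⟨
    (s ∪ singℕ p) ∪ singℕ (toℕ ℓ)  ∎

-- Least elements

record IsLeastFrom (P : ℕ → Set) (lb k : ℕ) : Set where
  field
    lower : lb ≤ k
    holds : P k
    least : ∀ {j} → lb ≤ j → j < k → ¬ P j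

open IsLeastFrom

isLeastFrom-unique : {P : ℕ → Set} {lb u v : ℕ} → IsLeastFrom P lb u → IsLeastFrom P lb v → u ≡ v
isLeastFrom-unique {u = u} {v} U V with <-cmp u v
... | tri< u<v _ _ = contradiction (holds U) (least V (lower U) u<v)
... | tri≈ _ u≡v _ = u≡v
... | tri> _ _ v<u = contradiction (holds V) (least U (lower V) v<u)

isLeastFrom-⇔ : {P Q : ℕ → Set} {lb k : ℕ} → (∀ {j} → P j ⇔ Q j) → IsLeastFrom P lb k → IsLeastFrom Q lb k
isLeastFrom-⇔ P⇔Q K = record
  { lower = lower K
  ; holds = to P⇔Q (holds K)
  ; least = λ lb≤j j<k → least K lb≤j j<k ∘ from P⇔Q
  }

isLeastFrom-+ : {P Q : ℕ → Set} {lb k′ k″ : ℕ} → (∀ {k} → P (k + k′) ⇔ Q k) →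
  lb ≤ k′ → (∀ {j} → lb ≤ j → j < k′ → ¬ P j) → IsLeastFrom Q 0 k″ → IsLeastFrom P lb (k″ + k′)
isLeastFrom-+ {P} {Q} {lb} {k′} {k″} P⇔Q lb≤k′ below K″ = record
  { lower = ≤-trans lb≤k′ (m≤n+m k′ k″)
  ; holds = from P⇔Q (holds K″)
  ; least = least′
  }
  where
  least′ : ∀ {j} → lb ≤ j → j < k″ + k′ → ¬ P j
  least′ {j} lb≤j j<k with j <? k′
  ... | yes j<k′ = below lb≤j j<k′
  ... | no  j≮k′ = λ Pj → least K″ z≤n (subst (j ∸ k′ <_) (m+n∸n≡m k″ k′) (∸-monoˡ-< j<k k′≤j))
                                       (to P⇔Q (subst P (sym (m∸n+n≡m k′≤j)) Pj))
    where k′≤j = ≮⇒≥ j≮k′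

search-isLeastFrom : ∀ {q n} (P : ℕ → Set) (P? : ∀ k → Dec (P k)) {lb r : ℕ} (fuel : ℕ) →
  lb ≤ r → r < lb + fuel → P r → IsLeastFrom P lb (search {q} {n} P P? lb fuel)
search-isLeastFrom P P? {lb} zero lb≤r r<lb+0 _ =
  contradiction (subst (_ <_) (+-identityʳ lb) r<lb+0) (≤⇒≯ lb≤r)
search-isLeastFrom {q} {n} P P? {lb} {r} (suc fuel) lb≤r r<lb+1+fuel Pr with P? lb
... | yes Plb = record { lower = ≤-refl ; holds = Plb ; least = λ lb≤j j<lb → contradiction j<lb (≤⇒≯ lb≤j) }
... | no ¬Plb = record { lower = ≤-trans (n≤1+n lb) (lower rest) ; holds = holds rest ; least = least′ }
  where
  rest : IsLeastFrom P (suc lb) (search {q} {n} P P? (suc lb) fuel)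
  rest = search-isLeastFrom {q} {n} P P? fuel (≤∧≢⇒< lb≤r (λ { refl → ¬Plb Pr }))
                            (subst (r <_) (+-suc lb fuel) r<lb+1+fuel) Pr
  least′ : ∀ {j} → lb ≤ j → j < search {q} {n} P P? (suc lb) fuel → ¬ P j
  least′ {j} lb≤j j<k with lb ≟ j
  ... | yes refl = ¬Plb
  ... | no  lb≢j = least rest (≤∧≢⇒< lb≤j lb≢j) j<k

-- Admissible shifts

module _ {q n : ℕ} (w : Vec (Fin q) n) where

  charAt-toℕ : (j : Fin n) → charAt w (toℕ j) ≡ just (lookup w j)
  charAt-toℕ j with toℕ j <? n
  ... | yes j<n = cong (just ∘ lookup w) (fromℕ<-toℕ j j<n)
  ... | no  j≮n = contradiction (toℕ<n j) j≮n

  charAt-≢ : ∀ {x} (i : Fin n) → x ≢ lookup w i → charAt w (toℕ i) ≢ just x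
  charAt-≢ i x≢wᵢ wᵢ≡x = x≢wᵢ (just-injective (trans (sym wᵢ≡x) (charAt-toℕ i)))

  PeriodicOn : Subset n → ℕ → Set
  PeriodicOn s k = ∀ j → j + k ∈ℕ s → charAt w j ≡ charAt w (j + k)

  periodicOn-⊥ : ∀ k → PeriodicOn ⊥ k
  periodicOn-⊥ k j (_ , _ , j′∈⊥) = contradiction j′∈⊥ ∉⊥

  -- Good with natural-number positions and without truncated subtraction.
  Good′ : Subset n → ℕ → Fin q → ℕ → Set
  Good′ s i x k = (∀ j → j + k ≡ i → charAt w j ≡ just x) × PeriodicOn s k

  Good⇔Good′ : ∀ {s i x k} → Good w s i x k ⇔ Good′ s i x k
  Good⇔Good′ {s} {i} {x} {k} = mk⇔ forth back
    where
    forth : Good w s i x k → Good′ s i x k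
    forth (reads , periodic) = reads′ , periodic′
      where
      reads′ : ∀ j → j + k ≡ i → charAt w j ≡ just x
      reads′ j refl = subst (λ u → charAt w u ≡ just x) (m+n∸n≡m j k) (reads (m≤n+m k j))
      periodic′ : PeriodicOn s k
      periodic′ j j+k∈s =
        subst (λ u → charAt w u ≡ charAt w (u + k)) (toℕ-fromℕ< j<n) (periodic (fromℕ< j<n) j∈s⊖k)
        where
        j<n = m+n≤o⇒m≤o (suc j) (∈ℕ⇒< j+k∈s)
        j∈s⊖k = to ∈ℕ⇔∈ (subst (_∈ℕ s ⊖ k) (sym (toℕ-fromℕ< j<n)) (from ∈ℕ-⊖ j+k∈s))
    back : Good′ s i x k → Good w s i x k
    back (reads , periodic) =
      (λ k≤i → reads (i ∸ k) (m∸n+n≡m k≤i)) ,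
      (λ j j∈s⊖k → periodic (toℕ j) (to ∈ℕ-⊖ (from ∈ℕ⇔∈ j∈s⊖k)))

  Good′-antitone : ∀ {a b i x k} → (∀ {p} → p ∈ℕ a → p ∈ℕ b) → Good′ b i x k → Good′ a i x k
  Good′-antitone a⊆b (reads , periodic) = reads , λ j → periodic j ∘ a⊆b

  ¬Good′-0 : ∀ {s x} (i : Fin n) → x ≢ lookup w i → ¬ Good′ s (toℕ i) x 0
  ¬Good′-0 i x≢wᵢ (reads , _) = charAt-≢ i x≢wᵢ (reads (toℕ i) (+-identityʳ (toℕ i)))

  Good′-own-letter : ∀ {s k} (i : Fin n) → Good′ s (toℕ i) (lookup w i) k ⇔ PeriodicOn (s ∪ ⁅ i ⁆) k
  Good′-own-letter {s} {k} i = mk⇔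
    (λ (reads , periodic) j → [ periodic j , (λ e → trans (reads j e) (sym (wᵢ e))) ] ∘ to ∈ℕ-∪⁅⁆)
    (λ periodic → (λ j e → trans (periodic j (from ∈ℕ-∪⁅⁆ (inj₂ e))) (wᵢ e)) ,
                  (λ j → periodic j ∘ from ∈ℕ-∪⁅⁆ ∘ inj₁))
    where
    wᵢ : ∀ {p} → p ≡ toℕ i → charAt w p ≡ just (lookup w i)
    wᵢ refl = charAt-toℕ i

  Good′-∪⁅⁆-shift : ∀ {s x k′ ℓ′ k} (i ℓ : Fin n) → Good′ s (toℕ i) x k′ → ℓ′ + k′ ≡ toℕ ℓ →
    Good′ (s ∪ ⁅ ℓ ⁆) (toℕ i) x (k + k′) ⇔ Good′ ((s ∪ singℕ (toℕ i)) ⊖ k′) ℓ′ (lookup w ℓ) k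
  Good′-∪⁅⁆-shift {s} {x} {k′} {ℓ′} {k} i ℓ (readsᵢ , periodic) ℓ′+k′≡ℓ = mk⇔ forth back
    where
    c = charAt w
    t = (s ∪ singℕ (toℕ i)) ⊖ k′
    assoc : ∀ j → j + k + k′ ≡ j + (k + k′)
    assoc j = +-assoc j k k′
    ∈t : ∀ {p} → p ∈ℕ t ⇔ (p + k′ ∈ℕ s ⊎ p + k′ ≡ toℕ i)
    ∈t {p} = ⇔.trans ∈ℕ-⊖ (subst (λ u → p + k′ ∈ℕ s ∪ u ⇔ (p + k′ ∈ℕ s ⊎ p + k′ ≡ toℕ i))
                                 (sym (singℕ-toℕ i)) ∈ℕ-∪⁅⁆)
    wℓ : ∀ {p} → p ≡ toℕ ℓ → c p ≡ just (lookup w ℓ)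
    wℓ refl = charAt-toℕ ℓ

    forth : Good′ (s ∪ ⁅ ℓ ⁆) (toℕ i) x (k + k′) → Good′ t ℓ′ (lookup w ℓ) k
    forth (reads , periodicₛ) = readsℓ , periodicₜ
      where
      readsℓ : ∀ j → j + k ≡ ℓ′ → c j ≡ just (lookup w ℓ)
      readsℓ j j+k≡ℓ′ = trans (periodicₛ j (from ∈ℕ-∪⁅⁆ (inj₂ j+k+k′≡ℓ))) (wℓ j+k+k′≡ℓ)
        where j+k+k′≡ℓ = trans (sym (assoc j)) (trans (cong (_+ k′) j+k≡ℓ′) ℓ′+k′≡ℓ)
      periodicₜ : PeriodicOn t k
      periodicₜ j j+k∈t with to ∈t j+k∈t
      ... | inj₁ j+k+k′∈s = trans (periodicₛ j (from ∈ℕ-∪⁅⁆ (inj₁ (subst (_∈ℕ s) (assoc j) j+k+k′∈s))))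
                                  (sym (trans (periodic (j + k) j+k+k′∈s) (cong c (assoc j))))
      ... | inj₂ j+k+k′≡i = trans (reads j (trans (sym (assoc j)) j+k+k′≡i)) (sym (readsᵢ (j + k) j+k+k′≡i))

    back : Good′ t ℓ′ (lookup w ℓ) k → Good′ (s ∪ ⁅ ℓ ⁆) (toℕ i) x (k + k′)
    back (readsℓ , periodicₜ) = reads , periodicₛ
      where
      reads : ∀ j → j + (k + k′) ≡ toℕ i → c j ≡ just x
      reads j e = trans (periodicₜ j (from ∈t (inj₂ j+k+k′≡i))) (readsᵢ (j + k) j+k+k′≡i)
        where j+k+k′≡i = trans (assoc j) e
      periodicₛ : PeriodicOn (s ∪ ⁅ ℓ ⁆) (k + k′)
      periodicₛ j j+k+k′∈ with to ∈ℕ-∪⁅⁆ j+k+k′∈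
      ... | inj₁ j+k+k′∈s = trans (periodicₜ j (from ∈t (inj₁ j+k+k′∈s′)))
                                  (trans (periodic (j + k) j+k+k′∈s′) (cong c (assoc j)))
        where j+k+k′∈s′ = subst (_∈ℕ s) (sym (assoc j)) j+k+k′∈s
      ... | inj₂ j+k+k′≡ℓ =
        trans (readsℓ j (+-cancelʳ-≡ k′ (j + k) ℓ′ (trans (assoc j) (trans j+k+k′≡ℓ (sym ℓ′+k′≡ℓ)))))
              (sym (wℓ j+k+k′≡ℓ))

  lowerBound≤1 : (s : Subset n) → lowerBound {q} s ≤ 1
  lowerBound≤1 s with ∣ s ∣ ≟ n ∸ 1
  ... | yes _ = ≤-refl
  ... | no  _ = z≤n

  lowerBound-full : (s : Subset n) → ∣ s ∣ ≡ n ∸ 1 → lowerBound {q} s ≡ 1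
  lowerBound-full s full with ∣ s ∣ ≟ n ∸ 1
  ... | yes _     = refl
  ... | no  ¬full = contradiction full ¬full

  lowerBound-nonfull : (s : Subset n) → ∣ s ∣ ≢ n ∸ 1 → lowerBound {q} s ≡ 0
  lowerBound-nonfull s ¬full with ∣ s ∣ ≟ n ∸ 1
  ... | yes full = contradiction full ¬full
  ... | no  _    = refl

  S-isLeastFrom : ∀ s {i} x → i < n → IsLeastFrom (Good′ s i x) (lowerBound {q} s) (S w s i x)
  S-isLeastFrom s {i} x i<n = isLeastFrom-⇔ Good⇔Good′
    (search-isLeastFrom {q} {n} (Good w s i x) (good? w s i x) (suc n)
      (≤-trans (lowerBound≤1 s) (≤-trans (s≤s z≤n) i<n)) (m≤n+m (suc n) (lowerBound {q} s))
      (from Good⇔Good′ Good′-n))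
    where
    Good′-n : Good′ s i x n
    Good′-n = (λ j j+n≡i → contradiction (subst (_< n) (sym j+n≡i) i<n) (m+n≮n j n))
            , (λ j j+n∈s → contradiction (∈ℕ⇒< j+n∈s) (m+n≮n j n))

  S-unique : ∀ s {i} x {k} → i < n → IsLeastFrom (Good′ s i x) (lowerBound {q} s) k → S w s i x ≡ k
  S-unique s x i<n = isLeastFrom-unique (S-isLeastFrom s x i<n)

  border⇒periodic : ∀ {b} → IsBorder w b → PeriodicOn ⊤ (n ∸ b)
  border⇒periodic {b} (b<n , border) j j+k∈⊤ = trans (border j j<b) (cong (charAt w) (+-comm (n ∸ b) j))
    where
    j<b : j < b
    j<b = +-cancelʳ-< (n ∸ b) j b (subst (j + (n ∸ b) <_) (sym (m+[n∸m]≡n (<⇒≤ b<n))) (∈ℕ⇒< j+k∈⊤))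

  periodic⇒border : ∀ {k} → 0 < k → k ≤ n → PeriodicOn ⊤ k → IsBorder w (n ∸ k)
  periodic⇒border {k} 0<k k≤n periodic = ∸-monoʳ-< 0<k k≤n , λ j j<n∸k →
    trans (periodic j (∈ℕ-⊤ (m≤o∸n⇒m+n≤o (suc j) k≤n j<n∸k)))
          (cong (charAt w) (trans (+-comm j k) (cong (_+ j) (sym (m∸[m∸n]≡n k≤n)))))

  longestBorder-isLeastPeriod : ∀ {B} → IsLongestBorder w B → IsLeastFrom (PeriodicOn ⊤) 1 (n ∸ B)
  longestBorder-isLeastPeriod {B} (border@(B<n , _) , longest) = record
    { lower = m<n⇒0<n∸m B<n
    ; holds = border⇒periodic border
    ; least = λ {k} 0<k k<n∸B periodic →
        let k≤n = ≤-trans (<⇒≤ k<n∸B) (m∸n≤m n B)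
        in <⇒≱ k<n∸B (subst (n ∸ B ≤_) (m∸[m∸n]≡n k≤n)
                        (∸-monoʳ-≤ n (longest (n ∸ k) (periodic⇒border 0<k k≤n periodic))))
    }

  IsLastOccurrence : ℕ → Fin q → ℕ → Set
  IsLastOccurrence i x p = p ≤ i × charAt w p ≡ just x × (∀ j → p < j → j ≤ i → charAt w j ≢ just x)

  P-just : ∀ {x} i {p} → P w i x ≡ just p → IsLastOccurrence i x p
  P-just {x} zero e with ≡-dec F._≟_ (charAt w 0) (just x)
  P-just zero refl | yes w₀≡x = z≤n , w₀≡x , λ j 0<j j≤0 → contradiction j≤0 (<⇒≱ 0<j)
  P-just zero ()   | no  _
  P-just {x} (suc i) e with ≡-dec F._≟_ (charAt w (suc i)) (just x)
  P-just (suc i) refl | yes wᵢ≡x = ≤-refl , wᵢ≡x , λ j i<j j≤i → contradiction j≤i (<⇒≱ i<j)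
  P-just (suc i) e    | no  wᵢ≢x with P-just i e
  ... | p≤i , wₚ≡x , later = m≤n⇒m≤1+n p≤i , wₚ≡x , later′
    where
    later′ : ∀ j → _ < j → j ≤ suc i → charAt w j ≢ just _
    later′ j p<j j≤1+i with m≤n⇒m<n∨m≡n j≤1+i
    ... | inj₁ j<1+i = later j p<j (≤-pred j<1+i)
    ... | inj₂ refl  = wᵢ≢x

  P-nothing : ∀ {x} i → P w i x ≡ nothing → ∀ j → j ≤ i → charAt w j ≢ just x
  P-nothing {x} zero e j j≤0 with ≡-dec F._≟_ (charAt w 0) (just x)
  P-nothing zero ()   j   j≤0 | yes _
  P-nothing zero e    .0  z≤n | no  w₀≢x = w₀≢x
  P-nothing {x} (suc i) e j j≤1+i with ≡-dec F._≟_ (charAt w (suc i)) (just x)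
  P-nothing (suc i) () j j≤1+i | yes _
  P-nothing (suc i) e  j j≤1+i | no  wᵢ≢x with m≤n⇒m<n∨m≡n j≤1+i
  ... | inj₁ j<1+i = P-nothing i e j (≤-pred j<1+i)
  ... | inj₂ refl  = wᵢ≢x

-- Computing T and S

module _ {q m : ℕ} (w : Vec (Fin q) (suc m)) where

  TS-own-letter : ∀ s (i : Fin (suc m)) → ∣ s ∣ ≢ m →
    (T w s (toℕ i) (lookup w i) ≡ s ∪ ⁅ i ⁆) × (S w s (toℕ i) (lookup w i) ≡ 0)
  TS-own-letter s i ¬full = T≡ , S≡0
    where
    S≡0 : S w s (toℕ i) (lookup w i) ≡ 0
    S≡0 = S-unique w s (lookup w i) (toℕ<n i) record
      { lower = ≤-reflexive (lowerBound-nonfull w s ¬full)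
      ; holds = from (Good′-own-letter w i) (λ j _ → cong (charAt w) (sym (+-identityʳ j)))
      ; least = λ _ j<0 → contradiction j<0 n≮0
      }
    T≡ : T w s (toℕ i) (lookup w i) ≡ s ∪ ⁅ i ⁆
    T≡ = begin
      (s ∪ singℕ (toℕ i)) ⊖ S w s (toℕ i) (lookup w i)  ≡⟨ cong ((s ∪ singℕ (toℕ i)) ⊖_) S≡0 ⟩
      (s ∪ singℕ (toℕ i)) ⊖ 0                           ≡⟨ ⊖-identityʳ _ ⟩
      s ∪ singℕ (toℕ i)                                 ≡⟨ cong (s ∪_) (singℕ-toℕ i) ⟩
      s ∪ ⁅ i ⁆                                         ∎
      where open ≡-Reasoning

  TS-own-letter-full : ∀ s (i : Fin (suc m)) → i ∉ s → ∣ s ∣ ≡ m → ∀ B → IsLongestBorder w B →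
    (T w s (toℕ i) (lookup w i) ≡ range B) × (S w s (toℕ i) (lookup w i) ≡ suc m ∸ B)
  TS-own-letter-full s i i∉s full B longest = T≡ , S≡
    where
    s∪⁅i⁆≡⊤ = ∪⁅⁆≡⊤ full i∉s
    B≤1+m = <⇒≤ (proj₁ (proj₁ longest))
    periodic⇔ : ∀ {k} → Good′ w s (toℕ i) (lookup w i) k ⇔ PeriodicOn w ⊤ k
    periodic⇔ {k} = subst (λ u → Good′ w s (toℕ i) (lookup w i) k ⇔ PeriodicOn w u k) s∪⁅i⁆≡⊤
                          (Good′-own-letter w i)
    S≡ : S w s (toℕ i) (lookup w i) ≡ suc m ∸ B
    S≡ = S-unique w s (lookup w i) (toℕ<n i)
           (subst (λ lb → IsLeastFrom (Good′ w s (toℕ i) (lookup w i)) lb (suc m ∸ B))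
                  (sym (lowerBound-full w s full))
                  (isLeastFrom-⇔ (⇔.sym periodic⇔) (longestBorder-isLeastPeriod w longest)))
    T≡ : T w s (toℕ i) (lookup w i) ≡ range B
    T≡ = begin
      (s ∪ singℕ (toℕ i)) ⊖ S w s (toℕ i) (lookup w i)  ≡⟨ cong₂ _⊖_ (trans (cong (s ∪_) (singℕ-toℕ i)) s∪⁅i⁆≡⊤) S≡ ⟩
      ⊤ ⊖ (suc m ∸ B)                                   ≡⟨ ⊤-⊖ (m∸n≤m (suc m) B) ⟩
      range (suc m ∸ (suc m ∸ B))                       ≡⟨ cong range (m∸[m∸n]≡n B≤1+m) ⟩
      range B                                           ∎
      where open ≡-Reasoning

  TS-⊥-occurrence : ∀ (i : Fin (suc m)) x → x ≢ lookup w i → ∀ p → P w (toℕ i) x ≡ just p →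
    (T w ⊥ (toℕ i) x ≡ singℕ p) × (S w ⊥ (toℕ i) x ≡ toℕ i ∸ p)
  TS-⊥-occurrence i x x≢wᵢ p Pᵢ≡p = T≡ , S≡
    where
    I = toℕ i
    lastOccurrence : IsLastOccurrence w I x p
    lastOccurrence = P-just w I Pᵢ≡p
    p≤I = proj₁ lastOccurrence
    wₚ≡x = proj₁ (proj₂ lastOccurrence)
    later = proj₂ (proj₂ lastOccurrence)
    p<I : p < I
    p<I = ≤∧≢⇒< p≤I λ p≡I → charAt-≢ w i x≢wᵢ (subst (λ u → charAt w u ≡ just x) p≡I wₚ≡x)
    S≡ : S w ⊥ I x ≡ I ∸ p
    S≡ = S-unique w ⊥ x (toℕ<n i) record
      { lower = ≤-trans (lowerBound≤1 w ⊥) (m<n⇒0<n∸m p<I)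
      ; holds = (λ j j+k≡I → subst (λ u → charAt w u ≡ just x)
                                   (sym (+-cancelʳ-≡ (I ∸ p) j p (trans j+k≡I (sym (m+[n∸m]≡n p≤I))))) wₚ≡x)
              , periodicOn-⊥ w (I ∸ p)
      ; least = λ {k} _ k<I∸p (reads , _) →
          later (I ∸ k) (subst (_< I ∸ k) (m∸[m∸n]≡n p≤I) (∸-monoʳ-< k<I∸p (m∸n≤m I p)))
                (m∸n≤m I k) (reads (I ∸ k) (m∸n+n≡m (≤-trans (<⇒≤ k<I∸p) (m∸n≤m I p))))
      }
    T≡ : T w ⊥ I x ≡ singℕ p
    T≡ = begin
      (⊥ ∪ singℕ I) ⊖ S w ⊥ I x  ≡⟨ cong₂ _⊖_ (∪-identityˡ _) S≡ ⟩
      singℕ I ⊖ (I ∸ p)          ≡⟨ singℕ-⊖ (m∸n≤m I p) (toℕ<n i) ⟩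
      singℕ (I ∸ (I ∸ p))        ≡⟨ cong singℕ (m∸[m∸n]≡n p≤I) ⟩
      singℕ p                    ∎
      where open ≡-Reasoning

  TS-⊥-noOccurrence : ∀ (i : Fin (suc m)) x → P w (toℕ i) x ≡ nothing →
    (T w ⊥ (toℕ i) x ≡ ⊥) × (S w ⊥ (toℕ i) x ≡ suc (toℕ i))
  TS-⊥-noOccurrence i x Pᵢ≡nothing = T≡ , S≡
    where
    I = toℕ i
    S≡ : S w ⊥ I x ≡ suc I
    S≡ = S-unique w ⊥ x (toℕ<n i) record
      { lower = ≤-trans (lowerBound≤1 w ⊥) (s≤s z≤n)
      ; holds = (λ j j+k≡I → contradiction (subst (suc I ≤_) j+k≡I (m≤n+m (suc I) j)) (n≮n I))
              , periodicOn-⊥ w (suc I)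
      ; least = λ {k} _ k<1+I (reads , _) →
          P-nothing w I Pᵢ≡nothing (I ∸ k) (m∸n≤m I k) (reads (I ∸ k) (m∸n+n≡m (≤-pred k<1+I)))
      }
    T≡ : T w ⊥ I x ≡ ⊥
    T≡ = begin
      (⊥ ∪ singℕ I) ⊖ S w ⊥ I x  ≡⟨ cong₂ _⊖_ (∪-identityˡ _) S≡ ⟩
      singℕ I ⊖ suc I            ≡⟨ singℕ-⊖-beyond (toℕ<n i) ≤-refl ⟩
      ⊥                          ∎
      where open ≡-Reasoning

  isLeastFrom-∪⁅⁆ : ∀ {s x k′ k″} (i ℓ : Fin (suc m)) → x ≢ lookup w i → ℓ ∉ s → ℓ ≢ i → k′ ≤ toℕ ℓ →
    IsLeastFrom (Good′ w s (toℕ i) x) (lowerBound {q} s) k′ →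
    IsLeastFrom (Good′ w ((s ∪ singℕ (toℕ i)) ⊖ k′) (toℕ ℓ ∸ k′) (lookup w ℓ))
                (lowerBound {q} ((s ∪ singℕ (toℕ i)) ⊖ k′)) k″ →
    IsLeastFrom (Good′ w (s ∪ ⁅ ℓ ⁆) (toℕ i) x) (lowerBound {q} (s ∪ ⁅ ℓ ⁆)) (k″ + k′)
  isLeastFrom-∪⁅⁆ {s} {x} {k′} {k″} i ℓ x≢wᵢ ℓ∉s ℓ≢i k′≤ℓ K′ K″ =
    isLeastFrom-+ (Good′-∪⁅⁆-shift w i ℓ (holds K′) ℓ′+k′≡ℓ) (≤-trans (lowerBound≤1 w (s ∪ ⁅ ℓ ⁆)) 0<k′) below
      (subst (λ lb → IsLeastFrom (Good′ w t ℓ′ (lookup w ℓ)) lb k″) (lowerBound-nonfull w t ∣t∣≢m) K″)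
    where
    t = (s ∪ singℕ (toℕ i)) ⊖ k′
    ℓ′ = toℕ ℓ ∸ k′
    0<k′ : 0 < k′
    0<k′ = n≢0⇒n>0 λ k′≡0 → ¬Good′-0 w i x≢wᵢ (subst (Good′ w s (toℕ i) x) k′≡0 (holds K′))
    ℓ′+k′≡ℓ : ℓ′ + k′ ≡ toℕ ℓ
    ℓ′+k′≡ℓ = m∸n+n≡m k′≤ℓ
    ℓ′<ℓ : ℓ′ < toℕ ℓ
    ℓ′<ℓ = subst (ℓ′ <_) ℓ′+k′≡ℓ (m<m+n ℓ′ 0<k′)
    ∈t : ∀ {p} → p ∈ℕ t ⇔ (p + k′ ∈ℕ s ⊎ p + k′ ≡ toℕ i)
    ∈t {p} = ⇔.trans ∈ℕ-⊖ (subst (λ u → p + k′ ∈ℕ s ∪ u ⇔ (p + k′ ∈ℕ s ⊎ p + k′ ≡ toℕ i))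
                                 (sym (singℕ-toℕ i)) ∈ℕ-∪⁅⁆)
    ℓ′∉t : ¬ ℓ′ ∈ℕ t
    ℓ′∉t = [ (λ ℓ∈ℕs → ℓ∉s (to ∈ℕ⇔∈ (subst (_∈ℕ s) ℓ′+k′≡ℓ ℓ∈ℕs)))
           , (λ ℓ≡i → ℓ≢i (toℕ-injective (trans (sym ℓ′+k′≡ℓ) ℓ≡i))) ] ∘ to ∈t
    m∉t : ¬ m ∈ℕ t
    m∉t = <⇒≱ (m<m+n m 0<k′) ∘ ≤-pred ∘ [ ∈ℕ⇒< , (λ m+k′≡i → subst (_< suc m) (sym m+k′≡i) (toℕ<n i)) ] ∘ to ∈t
    ∣t∣≢m : ∣ t ∣ ≢ m
    ∣t∣≢m full = <⇒≢ (<-≤-trans ℓ′<ℓ (≤-pred (toℕ<n ℓ)))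
                     (missingℕ-unique full (<-trans ℓ′<ℓ (toℕ<n ℓ)) ≤-refl ℓ′∉t m∉t)
    below : ∀ {j} → lowerBound {q} (s ∪ ⁅ ℓ ⁆) ≤ j → j < k′ → ¬ Good′ w (s ∪ ⁅ ℓ ⁆) (toℕ i) x j
    below {zero}  _ _    = ¬Good′-0 w i x≢wᵢ
    below {suc j} _ j<k′ = least K′ (≤-trans (lowerBound≤1 w s) (s≤s z≤n)) j<k′
                           ∘ Good′-antitone w (from ∈ℕ-∪⁅⁆ ∘ inj₁)

  -- k′, t and k″ are passed explicitly: inferring them by unification would make Agda evaluate S.
  TS-∪⁅⁆ : ∀ s s′ (i : Fin (suc m)) x ℓ → x ≢ lookup w i → s′ ∪ ⁅ ℓ ⁆ ≡ s → ℓ ∉ s′ → ℓ ≢ i →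
    let k′ = S w s′ (toℕ i) x
        t  = T w s′ (toℕ i) x
        ℓ′ = toℕ ℓ ∸ k′
    in k′ ≤ toℕ ℓ →
       (T w s (toℕ i) x ≡ T w t ℓ′ (lookup w ℓ)) × (S w s (toℕ i) x ≡ S w t ℓ′ (lookup w ℓ) + k′)
  TS-∪⁅⁆ _ s′ i x ℓ x≢wᵢ refl ℓ∉s′ ℓ≢i k′≤ℓ =
    let k′ = S w s′ (toℕ i) x
        t  = T w s′ (toℕ i) x
        k″ = S w t (toℕ ℓ ∸ k′) (lookup w ℓ)
        S≡ : S w (s′ ∪ ⁅ ℓ ⁆) (toℕ i) x ≡ k″ + k′
        S≡ = S-unique w (s′ ∪ ⁅ ℓ ⁆) x (toℕ<n i)
               (isLeastFrom-∪⁅⁆ {k′ = k′} {k″} i ℓ x≢wᵢ ℓ∉s′ ℓ≢i k′≤ℓ (S-isLeastFrom w s′ x (toℕ<n i))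
                 (S-isLeastFrom w t (lookup w ℓ) (≤-<-trans (m∸n≤m (toℕ ℓ) k′) (toℕ<n ℓ))))
    in trans (cong (((s′ ∪ ⁅ ℓ ⁆) ∪ singℕ (toℕ i)) ⊖_) S≡) (∪⁅⁆-⊖-+ s′ (toℕ i) ℓ {k′} {t} k″ k′≤ℓ refl) , S≡

lemma1 : {q m : ℕ} (w : Vec (Fin q) (suc m)) (s : Subset (suc m)) → s ≢ ⊤ →
  (i : Fin (suc m)) → i ∉ s → (x : Fin q) →
  (x ≡ lookup w i →
    (∣ s ∣ ≡ m → (B : ℕ) → IsLongestBorder w B →
       (T w s (toℕ i) x ≡ range B) × (S w s (toℕ i) x ≡ suc m ∸ B))
    × (∣ s ∣ ≢ m →
       (T w s (toℕ i) x ≡ s ∪ ⁅ i ⁆) × (S w s (toℕ i) x ≡ 0)))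
  × (x ≢ lookup w i →
    (s ≡ ⊥ →
      ((p : ℕ) → P w (toℕ i) x ≡ just p →
         (T w s (toℕ i) x ≡ singℕ p) × (S w s (toℕ i) x ≡ toℕ i ∸ p))
      × (P w (toℕ i) x ≡ nothing →
         (T w s (toℕ i) x ≡ ⊥) × (S w s (toℕ i) x ≡ suc (toℕ i))))
    × (s ≢ ⊥ → (ℓ : Fin (suc m)) → ℓ ∈ s →
         S w (s - ℓ) (toℕ i) x ≤ toℕ ℓ →
         (T w s (toℕ i) x
            ≡ T w (T w (s - ℓ) (toℕ i) x) (toℕ ℓ ∸ S w (s - ℓ) (toℕ i) x) (lookup w ℓ))
         × (S w s (toℕ i) x
            ≡ S w (T w (s - ℓ) (toℕ i) x) (toℕ ℓ ∸ S w (s - ℓ) (toℕ i) x) (lookup w ℓ)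
              + S w (s - ℓ) (toℕ i) x)))
lemma1 w s _ i i∉s x =
  -- The hypotheses s ≢ ⊤ and s ≢ ⊥ are implied by i ∉ s and ℓ ∈ s.
  (λ { refl → TS-own-letter-full w s i i∉s , TS-own-letter w s i }) ,
  (λ x≢wᵢ → (λ { refl → TS-⊥-occurrence w i x x≢wᵢ , TS-⊥-noOccurrence w i x })
           , λ _ ℓ ℓ∈s → TS-∪⁅⁆ w s (s - ℓ) i x ℓ x≢wᵢ (x∈p⇒p-x∪⁅x⁆≡p ℓ∈s) (x∉p-x ℓ)
                                (λ ℓ≡i → i∉s (subst (_∈ s) ℓ≡i ℓ∈s)))
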